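{- For all integers $n\geqslant 0$ and $r\geqslant 1$, $$\sum_{k=0}^{\infty}p\left( n-P(r+2,-k)\right) =S_r(n)+G_r(n),$$ where $P(s,m)=\dfrac{m^2(s-2)-m(s-4)}{2}$, so that $P(r+2,-k)=\dfrac{rk^2+(r-2)k}{2}$.
   Context: $p(m)$ denotes the number of integer partitions of $m$, with $p(0)=1$ and $p(m)=0$ for $m<0$. For a partition $\lambda$ and $r\geqslant 1$, $g_r(\lambda)$ is the smallest positive integer whose multiplicity as a part of $\lambda$ is less than $r$ (multiplicity $0$ allowed); by convention $g_0(\lambda)=\infty$. $S_r(n)=\sum_{\lambda\vdash n} g_r(\lambda)$. $G_r(n)$ is the number of partitions $\lambda$ of $n$ with $g_r(\lambda)<g_{r-1}(\lambda)$ (so $G_1(n)=p(n)$). -}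

module Defs where

open import Data.Bool using (Bool; true; false; if_then_else_)
open import Data.Nat using (ℕ; zero; suc; _+_; _*_; _∸_; _⊓_; _≡ᵇ_; _<ᵇ_)
open import Data.Integer as ℤ using (ℤ; +_; -[1+_])
open import Data.Integer.DivMod using (_/_)
open import Data.List using (List; []; _∷_; [_]; map; concatMap; upTo; length; filterᵇ)
open import Data.Nat.ListAction using (sum)

-- A partition is a weakly decreasing list of positive integers.
-- `boundedParts fuel n m` lists all partitions of n with every part ≤ m
-- (fuel ≥ n suffices, since each step removes a part ≥ 1).
boundedParts : ℕ → ℕ → ℕ → List (List ℕ)
boundedParts _        zero    _ = [ [] ]
boundedParts zero     (suc n) _ = []
boundedParts (suc f)  (suc n) m =
  concatMap (λ k → map (k ∷_) (boundedParts f (suc n ∸ k) k))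
            (map suc (upTo (suc n ⊓ m)))

partitions : ℕ → List (List ℕ)
partitions n = boundedParts n n n

p : ℕ → ℕ
p n = length (partitions n)

pℤ : ℤ → ℕ
pℤ (+ m)     = p m
pℤ -[1+ _ ]  = 0

mult : ℕ → List ℕ → ℕ
mult j λs = length (filterᵇ (λ x → x ≡ᵇ j) λs)

gSearch : ℕ → ℕ → ℕ → List ℕ → ℕ
gSearch zero     r j λs = j
gSearch (suc f)  r j λs = if mult j λs <ᵇ r then j else gSearch f r (suc j) λs

-- g_r(λ) for r ≥ 1: smallest positive integer with multiplicity < r.
-- (Among 1 … length λ + 1 some integer has multiplicity 0 < r, so the search
-- with fuel length λ starting at 1 is exhaustive.)
g : ℕ → List ℕ → ℕ
g r λs = gSearch (length λs) r 1 λs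

-- extended naturals, for g_0 = ∞
data ℕ∞ : Set where
  fin : ℕ → ℕ∞
  ∞   : ℕ∞

g∞ : ℕ → List ℕ → ℕ∞
g∞ zero    λs = ∞
g∞ (suc r) λs = fin (g (suc r) λs)

_<∞ᵇ_ : ℕ∞ → ℕ∞ → Bool
fin a <∞ᵇ fin b = a <ᵇ b
fin a <∞ᵇ ∞     = true
∞     <∞ᵇ _     = false

S : ℕ → ℕ → ℕ
S r n = sum (map (g r) (partitions n))

G : ℕ → ℕ → ℕ
G r n = length (filterᵇ (λ λs → g∞ r λs <∞ᵇ g∞ (r ∸ 1) λs) (partitions n))

-- generalized polygonal numbers P(s,m) = (m²(s-2) - m(s-4))/2  (always an integer)
P : ℤ → ℤ → ℤ
P s m = (m ℤ.* m ℤ.* (s ℤ.- + 2) ℤ.- m ℤ.* (s ℤ.- + 4)) / + 2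

sumTo : ℕ → (ℕ → ℕ) → ℕ
sumTo zero    f = 0
sumTo (suc K) f = sumTo K f + f K

module Submission where

-- Write r = r′ + 1 and let Dₖ (core r′ k) be the multiset with parts 1, …, k − 1 each r times
-- and the part k exactly r − 1 times, so that |Dₖ| = (r k² + (r − 2) k) / 2 = P(r + 2, −k).
-- Deleting Dₖ is a bijection from the partitions of n containing Dₖ onto the partitions of
-- n − |Dₖ|, so the k-th summand counts the partitions of n containing Dₖ. A partition λ
-- contains Dₖ exactly when k < g_r(λ), or k = g_r(λ) and that part occurs r − 1 times in λ,
-- which happens iff g_r(λ) < g_{r−1}(λ). Exchanging the two sums, each λ ⊢ n is therefore
-- counted g_r(λ) + [g_r(λ) < g_{r−1}(λ)] times, as soon as K exceeds g_r(λ) ≤ n + 1.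

open import Defs
open import Data.Bool using (Bool; true; false; T; _∧_; if_then_else_)
open import Data.Bool.Properties using (T-∧)
open import Data.Empty using (⊥-elim)
open import Data.Integer as ℤ using (+_; _⊖_)
open import Data.Integer.DivMod using (div-pos-is-/ℕ)
import Data.Integer.Properties as ℤ
import Data.Integer.Tactic.RingSolver as ℤ
open import Data.List
  using (List; []; _∷_; [_]; _++_; map; replicate; length; filterᵇ; upTo; concatMap)
open import Data.List.Membership.Propositional using (_∈_; find; lose)
open import Data.List.Membership.Propositional.Properties
  using (∈-concatMap⁺; ∈-concatMap⁻; ∈-map⁺; ∈-map⁻; ∈-upTo⁺; ∈-upTo⁻; ∈-filter⁺; ∈-filter⁻)
open import Data.List.Membership.Propositional.Properties.WithK using (unique∧set⇒bag)
open import Data.List.Properties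
  using (filter-accept; filter-reject; filter-++; filter-all; filter-none;
         length-++; length-map; length-replicate; map-cong-local)
open import Data.List.Relation.Binary.BagAndSetEquality using (_∼[_]_; set; ∼bag⇒↭)
open import Data.List.Relation.Binary.Permutation.Propositional.Properties using (↭-length)
open import Data.List.Relation.Unary.All as All using (All; []; _∷_)
import Data.List.Relation.Unary.All.Properties as All
open import Data.List.Relation.Unary.Any using (here)
open import Data.List.Relation.Unary.Unique.Propositional using (Unique; []; _∷_)
import Data.List.Relation.Unary.Unique.Propositional.Properties as Unique
open import Data.Nat
  using (ℕ; zero; suc; pred; _+_; _*_; _∸_; _≤_; _<_; z≤n; s≤s; _≡ᵇ_; _<ᵇ_; _⊓_; >-nonZero)
open import Data.Nat.DivMod using (m*n/n≡m)
open import Data.Nat.ListAction using (sum)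
open import Data.Nat.ListAction.Properties using (sum-++)
open import Data.Nat.Properties
import Data.Nat.Tactic.RingSolver as ℕ
open import Algebra.Properties.CommutativeSemigroup +-commutativeSemigroup
  using (x∙yz≈y∙xz; interchange)
open import Data.Product using (_×_; _,_; proj₁; proj₂; ∃₂)
open import Data.Sum using (_⊎_; inj₁; inj₂)
open import Function using (_∘_; _⇔_; mk⇔; Equivalence)
open import Relation.Binary.Definitions using (tri<; tri≈; tri>)
open import Relation.Binary.PropositionalEquality hiding ([_])
open import Relation.Nullary using (¬_; yes; no)
open import Relation.Nullary.Decidable using (T?)
open import Relation.Nullary.Reflects using (ofʸ; ofⁿ)

mult-++ : ∀ j xs ys → mult j (xs ++ ys) ≡ mult j xs + mult j ys
mult-++ j xs ys = trans (cong length (filter-++ (T? ∘ (_≡ᵇ j)) xs ys)) (length-++ (filterᵇ (_≡ᵇ j) xs))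

mult-∷ : ∀ j x xs → mult j (x ∷ xs) ≡ mult j [ x ] + mult j xs
mult-∷ j x = mult-++ j [ x ]

mult-here : ∀ j xs → mult j (j ∷ xs) ≡ suc (mult j xs)
mult-here j xs = cong length (filter-accept (T? ∘ (_≡ᵇ j)) {x = j} {xs = xs} (≡⇒≡ᵇ j j refl))

mult-there : ∀ {x} j xs → x ≢ j → mult j (x ∷ xs) ≡ mult j xs
mult-there {x} j xs x≢j = cong length (filter-reject (T? ∘ (_≡ᵇ j)) {x = x} {xs = xs} (x≢j ∘ ≡ᵇ⇒≡ x j))

0<mult-there : ∀ {x c} xs → x ≢ c → 0 < mult c (x ∷ xs) → 0 < mult c xs
0<mult-there {c = c} xs x≢c = subst (0 <_) (mult-there c xs x≢c)

mult-replicate : ∀ a v → mult v (replicate a v) ≡ a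
mult-replicate zero    v = refl
mult-replicate (suc a) v = trans (mult-here v (replicate a v)) (cong suc (mult-replicate a v))

mult-replicate-≢ : ∀ a {v} i → v ≢ i → mult i (replicate a v) ≡ 0
mult-replicate-≢ zero    i v≢i = refl
mult-replicate-≢ (suc a) i v≢i = trans (mult-there i _ v≢i) (mult-replicate-≢ a i v≢i)

-- Partitions as weakly decreasing lists of positive parts

data Partition≤ : ℕ → List ℕ → Set where
  []  : ∀ {m} → Partition≤ m []
  _∷_ : ∀ {m k xs} → 1 ≤ k × k ≤ m → Partition≤ k xs → Partition≤ m (k ∷ xs)

Partition≤-weaken : ∀ {m m′ xs} → m ≤ m′ → Partition≤ m xs → Partition≤ m′ xs
Partition≤-weaken m≤m′ []                  = []
Partition≤-weaken m≤m′ ((1≤k , k≤m) ∷ ks) = (1≤k , ≤-trans k≤m m≤m′) ∷ ks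

Partition≤-sum : ∀ {m xs} → Partition≤ m xs → Partition≤ (sum xs) xs
Partition≤-sum []               = []
Partition≤-sum ((1≤k , _) ∷ ks) = (1≤k , m≤m+n _ _) ∷ ks

part≤bound : ∀ {m xs} c → Partition≤ m xs → 0 < mult c xs → c ≤ m
part≤bound c [] ()
part≤bound c (_∷_ {k = k} {xs} (_ , k≤m) ks) c∈ with k ≟ c
... | yes refl = k≤m
... | no k≢c   = ≤-trans (part≤bound c ks (0<mult-there xs k≢c c∈)) k≤m

length≤sum : ∀ {m xs} → Partition≤ m xs → length xs ≤ sum xs
length≤sum []               = z≤n
length≤sum ((1≤k , _) ∷ ks) = +-mono-≤ 1≤k (length≤sum ks)

insert : ℕ → List ℕ → List ℕ
insert c []       = [ c ]
insert c (x ∷ xs) with x ≤? c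
... | yes _ = c ∷ x ∷ xs
... | no  _ = x ∷ insert c xs

remove : ℕ → List ℕ → List ℕ
remove c []       = []
remove c (x ∷ xs) with x ≟ c
... | yes _ = xs
... | no  _ = x ∷ remove c xs

remove-insert : ∀ c xs → remove c (insert c xs) ≡ xs
remove-insert c [] rewrite ≟-diag (refl {x = c}) = refl
remove-insert c (x ∷ xs) with x ≤? c
... | yes _ rewrite ≟-diag (refl {x = c}) = refl
... | no x≰c with x ≟ c
...   | yes refl = ⊥-elim (x≰c ≤-refl)
...   | no _     = cong (x ∷_) (remove-insert c xs)

insert-injective : ∀ c {xs ys} → insert c xs ≡ insert c ys → xs ≡ ys
insert-injective c {xs} {ys} eq =
  trans (sym (remove-insert c xs)) (trans (cong (remove c) eq) (remove-insert c ys))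

insert-≥ : ∀ c {xs} → Partition≤ c xs → insert c xs ≡ c ∷ xs
insert-≥ c []                      = refl
insert-≥ c {x ∷ _} ((_ , x≤c) ∷ _) with x ≤? c
... | yes _   = refl
... | no x≰c = ⊥-elim (x≰c x≤c)

insert-remove : ∀ {m} c {xs} → Partition≤ m xs → 0 < mult c xs → insert c (remove c xs) ≡ xs
insert-remove c [] ()
insert-remove c {x ∷ xs} (_ ∷ ks) c∈ with x ≟ c
... | yes refl = insert-≥ x ks
... | no x≢c with x ≤? c
...   | yes x≤c = ⊥-elim (x≢c (≤-antisym x≤c (part≤bound c ks (0<mult-there xs x≢c c∈))))
...   | no _    = cong (x ∷_) (insert-remove c ks (0<mult-there xs x≢c c∈))

insert-Partition≤ : ∀ {m} c {xs} → 1 ≤ c × c ≤ m → Partition≤ m xs → Partition≤ m (insert c xs)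
insert-Partition≤ c bounds [] = bounds ∷ []
insert-Partition≤ c {x ∷ _} bounds ((1≤x , x≤m) ∷ ks) with x ≤? c
... | yes x≤c = bounds ∷ ((1≤x , x≤c) ∷ ks)
... | no x≰c  = (1≤x , x≤m) ∷ insert-Partition≤ c (proj₁ bounds , <⇒≤ (≰⇒> x≰c)) ks

remove-Partition≤ : ∀ {m} c {xs} → Partition≤ m xs → Partition≤ m (remove c xs)
remove-Partition≤ c [] = []
remove-Partition≤ c {x ∷ _} (bounds@(_ , x≤m) ∷ ks) with x ≟ c
... | yes _ = Partition≤-weaken x≤m ks
... | no _  = bounds ∷ remove-Partition≤ c ks

sum-insert : ∀ c xs → sum (insert c xs) ≡ c + sum xs
sum-insert c [] = refl
sum-insert c (x ∷ xs) with x ≤? c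
... | yes _ = refl
... | no _  = trans (cong (_+_ x) (sum-insert c xs)) (x∙yz≈y∙xz x c (sum xs))

sum-remove : ∀ c xs → 0 < mult c xs → c + sum (remove c xs) ≡ sum xs
sum-remove c [] ()
sum-remove c (x ∷ xs) c∈ with x ≟ c
... | yes refl = refl
... | no x≢c   = trans (x∙yz≈y∙xz c x _) (cong (_+_ x) (sum-remove c xs (0<mult-there xs x≢c c∈)))

length-remove : ∀ c xs → 0 < mult c xs → suc (length (remove c xs)) ≡ length xs
length-remove c [] ()
length-remove c (x ∷ xs) c∈ with x ≟ c
... | yes refl = refl
... | no x≢c   = cong suc (length-remove c xs (0<mult-there xs x≢c c∈))

mult-insert : ∀ c xs → mult c (insert c xs) ≡ suc (mult c xs)
mult-insert c [] = mult-here c []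
mult-insert c (x ∷ xs) with x ≤? c
... | yes _  = mult-here c (x ∷ xs)
... | no x≰c = begin
  mult c (x ∷ insert c xs)  ≡⟨ mult-there c _ x≢c ⟩
  mult c (insert c xs)      ≡⟨ mult-insert c xs ⟩
  suc (mult c xs)           ≡⟨ cong suc (mult-there c xs x≢c) ⟨
  suc (mult c (x ∷ xs))     ∎
  where
  open ≡-Reasoning
  x≢c : x ≢ c
  x≢c refl = x≰c ≤-refl

mult-remove : ∀ i c xs → 0 < mult c xs → mult i [ c ] + mult i (remove c xs) ≡ mult i xs
mult-remove i c [] ()
mult-remove i c (x ∷ xs) c∈ with x ≟ c
... | yes refl = sym (mult-∷ i x xs)
... | no x≢c   = begin
  mult i [ c ] + mult i (x ∷ remove c xs)              ≡⟨ cong (_+_ (mult i [ c ])) (mult-∷ i x (remove c xs)) ⟩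
  mult i [ c ] + (mult i [ x ] + mult i (remove c xs)) ≡⟨ x∙yz≈y∙xz (mult i [ c ]) (mult i [ x ]) _ ⟩
  mult i [ x ] + (mult i [ c ] + mult i (remove c xs)) ≡⟨ cong (_+_ (mult i [ x ])) (mult-remove i c xs c∈xs) ⟩
  mult i [ x ] + mult i xs                             ≡⟨ mult-∷ i x xs ⟨
  mult i (x ∷ xs)                                      ∎
  where
  open ≡-Reasoning
  c∈xs = 0<mult-there xs x≢c c∈

module _ (F : ℕ → List (List ℕ)) where

  prefixed : List ℕ → List (List ℕ)
  prefixed = concatMap (λ k → map (k ∷_) (F k))

  ∈-prefixed⁻ : ∀ {ks xs} → xs ∈ prefixed ks → ∃₂ λ k ys → k ∈ ks × ys ∈ F k × xs ≡ k ∷ ys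
  ∈-prefixed⁻ {ks} xs∈ with find (∈-concatMap⁻ (λ k → map (k ∷_) (F k)) {xs = ks} xs∈)
  ... | k , k∈ks , xs∈F with ∈-map⁻ (k ∷_) xs∈F
  ...   | ys , ys∈F , refl = k , ys , k∈ks , ys∈F , refl

  ∈-prefixed⁺ : ∀ {ks k ys} → k ∈ ks → ys ∈ F k → k ∷ ys ∈ prefixed ks
  ∈-prefixed⁺ k∈ks ys∈F = ∈-concatMap⁺ (λ k → map (k ∷_) (F k)) (lose k∈ks (∈-map⁺ (_ ∷_) ys∈F))

  prefixed-unique : ∀ {ks} → Unique ks → (∀ k → Unique (F k)) → Unique (prefixed ks)
  prefixed-unique []                   _  = []
  prefixed-unique {k ∷ ks} (k∉ks ∷ ks!) F! =
    Unique.++⁺ (Unique.map⁺ (λ { refl → refl }) (F! k)) (prefixed-unique ks! F!) disjoint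
    where
    disjoint : ∀ {xs} → ¬ (xs ∈ map (k ∷_) (F k) × xs ∈ prefixed ks)
    disjoint (xs∈head , xs∈tail) with ∈-map⁻ (k ∷_) xs∈head | ∈-prefixed⁻ {ks} xs∈tail
    ... | _ , _ , refl | _ , _ , k∈ks , _ , refl = All.lookup k∉ks k∈ks refl

∈-boundedParts⁻ : ∀ f n m {xs} → xs ∈ boundedParts f n m → Partition≤ m xs × sum xs ≡ n
∈-boundedParts⁻ _       zero    _ (here refl) = [] , refl
∈-boundedParts⁻ (suc f) (suc n) m xs∈
  with ∈-prefixed⁻ (λ k → boundedParts f (suc n ∸ k) k) {map suc (upTo (suc n ⊓ m))} xs∈
... | k , ys , k∈ , ys∈ , refl with ∈-map⁻ suc k∈
...   | i , i∈ , refl with ∈-boundedParts⁻ f (suc n ∸ suc i) (suc i) ys∈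
...     | ys-part , sum-ys =
  (s≤s z≤n , ≤-trans i< (m⊓n≤n (suc n) m)) ∷ ys-part ,
  trans (cong (_+_ (suc i)) sum-ys) (m+[n∸m]≡n (≤-trans i< (m⊓n≤m (suc n) m)))
  where i< = ∈-upTo⁻ i∈

∈-boundedParts⁺ : ∀ f n m {xs} → Partition≤ m xs → sum xs ≡ n → n ≤ f → xs ∈ boundedParts f n m
∈-boundedParts⁺ _       zero    _ []                 _  _ = here refl
∈-boundedParts⁺ _       zero    _ ((s≤s _ , _) ∷ _) () _
∈-boundedParts⁺ (suc f) (suc n) m {suc i ∷ ys} ((_ , k≤m) ∷ ys-part) sum-xs (s≤s n≤f) =
  ∈-prefixed⁺ (λ k → boundedParts f (suc n ∸ k) k)
    (∈-map⁺ suc (∈-upTo⁺ (⊓-glb k≤1+n k≤m)))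
    (∈-boundedParts⁺ f (n ∸ i) (suc i) ys-part sum-ys (≤-trans (m∸n≤m n i) n≤f))
  where
  k≤1+n : suc i ≤ suc n
  k≤1+n = subst (suc i ≤_) sum-xs (m≤m+n (suc i) (sum ys))
  sum-ys : sum ys ≡ n ∸ i
  sum-ys = sym (trans (cong (_∸ suc i) (sym sum-xs)) (m+n∸m≡n (suc i) (sum ys)))

boundedParts-unique : ∀ f n m → Unique (boundedParts f n m)
boundedParts-unique _       zero    _ = All.[] ∷ []
boundedParts-unique zero    (suc n) _ = []
boundedParts-unique (suc f) (suc n) m =
  prefixed-unique (λ k → boundedParts f (suc n ∸ k) k)
    (Unique.map⁺ suc-injective (Unique.upTo⁺ (suc n ⊓ m)))
    (λ k → boundedParts-unique f (suc n ∸ k) k)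

∈-partitions⁻ : ∀ {n xs} → xs ∈ partitions n → Partition≤ n xs × sum xs ≡ n
∈-partitions⁻ {n} = ∈-boundedParts⁻ n n n

∈-partitions⁺ : ∀ {n xs} → Partition≤ n xs → sum xs ≡ n → xs ∈ partitions n
∈-partitions⁺ {n} xs-part sum-xs = ∈-boundedParts⁺ n n n xs-part sum-xs ≤-refl

partitions-unique : ∀ n → Unique (partitions n)
partitions-unique n = boundedParts-unique n n n

length≤n : ∀ {n xs} → xs ∈ partitions n → length xs ≤ n
length≤n xs∈ with ∈-partitions⁻ xs∈
... | xs-part , sum-xs = subst (_ ≤_) sum-xs (length≤sum xs-part)

-- Counting partitions that contain a given multiset

length-unique : ∀ {A : Set} {xs ys : List A} → Unique xs → Unique ys → xs ∼[ set ] ys → length xs ≡ length ys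
length-unique xs! ys! xs≈ys = ↭-length (∼bag⇒↭ (unique∧set⇒bag xs! ys! xs≈ys))

partitionsWith : (List ℕ → Bool) → ℕ → List (List ℕ)
partitionsWith q n = filterᵇ q (partitions n)

count : (List ℕ → Bool) → ℕ → ℕ
count q n = length (partitionsWith q n)

∈-partitionsWith⁻ : ∀ q {n xs} → xs ∈ partitionsWith q n → (Partition≤ n xs × sum xs ≡ n) × T (q xs)
∈-partitionsWith⁻ q {n} xs∈ with ∈-filter⁻ (T? ∘ q) {xs = partitions n} xs∈
... | xs∈ₚ , q-xs = ∈-partitions⁻ xs∈ₚ , q-xs

∈-partitionsWith⁺ : ∀ q {n xs} → Partition≤ n xs → sum xs ≡ n → T (q xs) → xs ∈ partitionsWith q n
∈-partitionsWith⁺ q xs-part sum-xs = ∈-filter⁺ (T? ∘ q) (∈-partitions⁺ xs-part sum-xs)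

partitionsWith-unique : ∀ q n → Unique (partitionsWith q n)
partitionsWith-unique q n = Unique.filter⁺ (T? ∘ q) (partitions-unique n)

withPart : ℕ → (List ℕ → Bool) → List ℕ → Bool
withPart c q xs = (0 <ᵇ mult c xs) ∧ q (remove c xs)

withPart⇒ : ∀ c q xs → T (withPart c q xs) → 0 < mult c xs × T (q (remove c xs))
withPart⇒ c q xs hyp with Equivalence.to (T-∧ {0 <ᵇ mult c xs}) hyp
... | c∈ , q-rest = <ᵇ⇒< 0 _ c∈ , q-rest

⇒withPart : ∀ c q xs → 0 < mult c xs → T (q (remove c xs)) → T (withPart c q xs)
⇒withPart c q xs c∈ q-rest = Equivalence.from T-∧ (<⇒<ᵇ c∈ , q-rest)

count-withPart : ∀ c q {n} → 1 ≤ c → c ≤ n → count (withPart c q) n ≡ count q (n ∸ c)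
count-withPart c q {n} 1≤c c≤n =
  trans (length-unique (partitionsWith-unique (withPart c q) n)
                       (Unique.map⁺ (insert-injective c) (partitionsWith-unique q (n ∸ c)))
                       (mk⇔ to from))
        (length-map (insert c) (partitionsWith q (n ∸ c)))
  where
  to : ∀ {xs} → xs ∈ partitionsWith (withPart c q) n → xs ∈ map (insert c) (partitionsWith q (n ∸ c))
  to {xs} xs∈ with ∈-partitionsWith⁻ (withPart c q) xs∈
  ... | (xs-part , sum-xs) , hyp with withPart⇒ c q xs hyp
  ...   | c∈ , q-rest = subst (_∈ map (insert c) _) (insert-remove c xs-part c∈)
    (∈-map⁺ (insert c) (∈-partitionsWith⁺ q rest-part sum-rest q-rest))
    where
    sum-rest : sum (remove c xs) ≡ n ∸ c
    sum-rest = sym (trans (cong (_∸ c) (trans (sym sum-xs) (sym (sum-remove c xs c∈)))) (m+n∸m≡n c _))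
    rest-part = subst (λ m → Partition≤ m (remove c xs)) sum-rest (Partition≤-sum (remove-Partition≤ c xs-part))
  from : ∀ {xs} → xs ∈ map (insert c) (partitionsWith q (n ∸ c)) → xs ∈ partitionsWith (withPart c q) n
  from xs∈ with ∈-map⁻ (insert c) xs∈
  ... | ys , ys∈ , refl with ∈-partitionsWith⁻ q ys∈
  ...   | (ys-part , sum-ys) , q-ys = ∈-partitionsWith⁺ (withPart c q)
    (insert-Partition≤ c (1≤c , c≤n) (Partition≤-weaken (m∸n≤m n c) ys-part))
    (trans (sum-insert c ys) (trans (cong (_+_ c) sum-ys) (m+[n∸m]≡n c≤n)))
    (⇒withPart c q (insert c ys) (subst (0 <_) (sym (mult-insert c ys)) (s≤s z≤n))
                                 (subst (T ∘ q) (sym (remove-insert c ys)) q-ys))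

count-withPart-> : ∀ c q {n} → n < c → count (withPart c q) n ≡ 0
count-withPart-> c q {n} n<c = cong length (filter-none (T? ∘ withPart c q) (All.tabulate absent))
  where
  absent : ∀ {xs} → xs ∈ partitions n → ¬ T (withPart c q xs)
  absent {xs} xs∈ hyp with ∈-partitions⁻ xs∈
  ... | _ , sum-xs = <⇒≱ n<c (≤-trans (m≤m+n c _) (≤-reflexive (trans (sum-remove c xs c∈) sum-xs)))
    where c∈ = proj₁ (withPart⇒ c q xs hyp)

contains : List ℕ → List ℕ → Bool
contains []      = λ _ → true
contains (c ∷ D) = withPart c (contains D)

pℤ-⊖-< : ∀ {m n} → m < n → pℤ (m ⊖ n) ≡ 0
pℤ-⊖-< {zero}  {suc n} _         = refl
pℤ-⊖-< {suc m} {suc n} (s≤s m<n) = trans (cong pℤ (ℤ.[1+m]⊖[1+n]≡m⊖n m n)) (pℤ-⊖-< m<n)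

count-contains : ∀ D n → All (1 ≤_) D → count (contains D) n ≡ pℤ (n ⊖ sum D)
count-contains [] n [] = cong length (filter-all (T? ∘ contains []) (All.tabulate {xs = partitions n} _))
count-contains (c ∷ D) n (1≤c ∷ D⁺) with c ≤? n
... | yes c≤n = begin
  count (withPart c (contains D)) n  ≡⟨ count-withPart c (contains D) 1≤c c≤n ⟩
  count (contains D) (n ∸ c)         ≡⟨ count-contains D (n ∸ c) D⁺ ⟩
  pℤ ((n ∸ c) ⊖ sum D)               ≡⟨ cong pℤ (ℤ.+-cancelˡ-⊖ c (n ∸ c) (sum D)) ⟨
  pℤ ((c + (n ∸ c)) ⊖ (c + sum D))   ≡⟨ cong (λ m → pℤ (m ⊖ (c + sum D))) (m+[n∸m]≡n c≤n) ⟩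
  pℤ (n ⊖ (c + sum D))               ∎
  where open ≡-Reasoning
... | no c≰n = trans (count-withPart-> c (contains D) (≰⇒> c≰n))
                     (sym (pℤ-⊖-< (<-≤-trans (≰⇒> c≰n) (m≤m+n c (sum D)))))

contains⇒mult≤ : ∀ D xs → T (contains D xs) → ∀ i → mult i D ≤ mult i xs
contains⇒mult≤ []      xs _   i = z≤n
contains⇒mult≤ (c ∷ D) xs hyp i with withPart⇒ c (contains D) xs hyp
... | c∈ , D⊑rest = begin
  mult i (c ∷ D)                      ≡⟨ mult-∷ i c D ⟩
  mult i [ c ] + mult i D             ≤⟨ +-monoʳ-≤ (mult i [ c ]) (contains⇒mult≤ D (remove c xs) D⊑rest i) ⟩
  mult i [ c ] + mult i (remove c xs) ≡⟨ mult-remove i c xs c∈ ⟩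
  mult i xs                           ∎
  where open ≤-Reasoning

mult≤⇒contains : ∀ D xs → (∀ i → mult i D ≤ mult i xs) → T (contains D xs)
mult≤⇒contains []      xs _    = _
mult≤⇒contains (c ∷ D) xs D≤xs = ⇒withPart c (contains D) xs c∈ (mult≤⇒contains D (remove c xs) D≤rest)
  where
  c∈ : 0 < mult c xs
  c∈ = ≤-trans (s≤s z≤n) (subst (_≤ mult c xs) (mult-here c D) (D≤xs c))
  D≤rest : ∀ i → mult i D ≤ mult i (remove c xs)
  D≤rest i = +-cancelˡ-≤ (mult i [ c ]) _ _
    (subst₂ _≤_ (mult-∷ i c D) (sym (mult-remove i c xs c∈)) (D≤xs i))

contains⇒length≤ : ∀ D xs → T (contains D xs) → length D ≤ length xs
contains⇒length≤ []      xs _   = z≤n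
contains⇒length≤ (c ∷ D) xs hyp with withPart⇒ c (contains D) xs hyp
... | c∈ , D⊑rest = subst (suc (length D) ≤_) (length-remove c xs c∈)
                          (s≤s (contains⇒length≤ D (remove c xs) D⊑rest))

-- The multisets Dₖ

staircase : ℕ → ℕ → List ℕ
staircase a zero    = []
staircase a (suc j) = replicate a (suc j) ++ staircase a j

mult-staircase-> : ∀ a {j i} → j < i → mult i (staircase a j) ≡ 0
mult-staircase-> a {zero}  j<i = refl
mult-staircase-> a {suc j} {i} j<i = begin
  mult i (replicate a (suc j) ++ staircase a j)           ≡⟨ mult-++ i (replicate a (suc j)) _ ⟩
  mult i (replicate a (suc j)) + mult i (staircase a j)  ≡⟨ cong₂ _+_ (mult-replicate-≢ a i (<⇒≢ j<i))
                                                                      (mult-staircase-> a (<-trans (n<1+n j) j<i)) ⟩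
  0                                                       ∎
  where open ≡-Reasoning

mult-staircase-0 : ∀ a j → mult 0 (staircase a j) ≡ 0
mult-staircase-0 a zero    = refl
mult-staircase-0 a (suc j) =
  trans (mult-++ 0 (replicate a (suc j)) _) (cong₂ _+_ (mult-replicate-≢ a 0 (λ ())) (mult-staircase-0 a j))

mult-staircase-≤ : ∀ a {j i} → 1 ≤ i → i ≤ j → mult i (staircase a j) ≡ a
mult-staircase-≤ a {zero} (s≤s _) ()
mult-staircase-≤ a {suc j} {i} 1≤i i≤1+j with i ≟ suc j
... | yes refl = begin
  mult i (replicate a i ++ staircase a j)           ≡⟨ mult-++ i (replicate a i) _ ⟩
  mult i (replicate a i) + mult i (staircase a j)  ≡⟨ cong₂ _+_ (mult-replicate a i) (mult-staircase-> a (n<1+n j)) ⟩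
  a + 0                                             ≡⟨ +-identityʳ a ⟩
  a                                                 ∎
  where open ≡-Reasoning
... | no i≢1+j = begin
  mult i (replicate a (suc j) ++ staircase a j)          ≡⟨ mult-++ i (replicate a (suc j)) _ ⟩
  mult i (replicate a (suc j)) + mult i (staircase a j) ≡⟨ cong₂ _+_ (mult-replicate-≢ a i (i≢1+j ∘ sym))
                                                                     (mult-staircase-≤ a 1≤i i≤j) ⟩
  a                                                      ∎
  where
  open ≡-Reasoning
  i≤j = ≤-pred (≤∧≢⇒< i≤1+j i≢1+j)

length-staircase : ∀ a j → length (staircase a j) ≡ j * a
length-staircase a zero    = refl
length-staircase a (suc j) =
  trans (length-++ (replicate a (suc j))) (cong₂ _+_ (length-replicate a) (length-staircase a j))

contains-staircase : ∀ a j xs → (∀ {i} → 1 ≤ i → i ≤ j → a ≤ mult i xs) → T (contains (staircase a j) xs)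
contains-staircase a j xs below = mult≤⇒contains (staircase a j) xs bound
  where
  bound : ∀ i → mult i (staircase a j) ≤ mult i xs
  bound zero = subst (_≤ mult 0 xs) (sym (mult-staircase-0 a j)) z≤n
  bound (suc i) with suc i ≤? j
  ... | yes i<j = subst (_≤ mult (suc i) xs) (sym (mult-staircase-≤ a (s≤s z≤n) i<j)) (below (s≤s z≤n) i<j)
  ... | no  i≮j = subst (_≤ mult (suc i) xs) (sym (mult-staircase-> a (≰⇒> i≮j))) z≤n

core : ℕ → ℕ → List ℕ
core r′ zero    = []
core r′ (suc j) = replicate r′ (suc j) ++ staircase (suc r′) j

module _ (r′ j : ℕ) where

  private
    mult-core : ∀ i → mult i (core r′ (suc j)) ≡ mult i (replicate r′ (suc j)) + mult i (staircase (suc r′) j)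
    mult-core i = mult-++ i (replicate r′ (suc j)) _

  mult-core-top : mult (suc j) (core r′ (suc j)) ≡ r′
  mult-core-top = trans (mult-core (suc j))
    (trans (cong₂ _+_ (mult-replicate r′ (suc j)) (mult-staircase-> (suc r′) (n<1+n j))) (+-identityʳ r′))

  mult-core-≤ : ∀ {i} → 1 ≤ i → i ≤ j → mult i (core r′ (suc j)) ≡ suc r′
  mult-core-≤ {i} 1≤i i≤j = trans (mult-core i)
    (cong₂ _+_ (mult-replicate-≢ r′ i (<⇒≢ (s≤s i≤j) ∘ sym)) (mult-staircase-≤ (suc r′) 1≤i i≤j))

  mult-core-> : ∀ {i} → suc j < i → mult i (core r′ (suc j)) ≡ 0
  mult-core-> {i} 1+j<i = trans (mult-core i)
    (cong₂ _+_ (mult-replicate-≢ r′ i (<⇒≢ 1+j<i)) (mult-staircase-> (suc r′) (<-trans (n<1+n j) 1+j<i)))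

  mult-core-0 : mult 0 (core r′ (suc j)) ≡ 0
  mult-core-0 = trans (mult-core 0) (cong₂ _+_ (mult-replicate-≢ r′ 0 (λ ())) (mult-staircase-0 (suc r′) j))

  contains-core⇔ : ∀ xs → T (contains (core r′ (suc j)) xs) ⇔
    ((∀ i → 1 ≤ i → i ≤ j → suc r′ ≤ mult i xs) × r′ ≤ mult (suc j) xs)
  contains-core⇔ xs = mk⇔
    (λ hyp → let core≤xs = contains⇒mult≤ (core r′ (suc j)) xs hyp in
      (λ i 1≤i i≤j → subst (_≤ mult i xs) (mult-core-≤ 1≤i i≤j) (core≤xs i)) ,
      subst (_≤ mult (suc j) xs) mult-core-top (core≤xs (suc j)))
    (λ (below , top) → mult≤⇒contains (core r′ (suc j)) xs (core≤xs below top))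
    where
    core≤xs : (∀ i → 1 ≤ i → i ≤ j → suc r′ ≤ mult i xs) → r′ ≤ mult (suc j) xs →
              ∀ i → mult i (core r′ (suc j)) ≤ mult i xs
    core≤xs below top zero = subst (_≤ mult 0 xs) (sym mult-core-0) z≤n
    core≤xs below top (suc i) with <-cmp (suc i) (suc j)
    ... | tri< (s≤s i<j) _ _ = subst (_≤ mult (suc i) xs) (sym (mult-core-≤ (s≤s z≤n) i<j)) (below (suc i) (s≤s z≤n) i<j)
    ... | tri≈ _ refl _       = subst (_≤ mult (suc i) xs) (sym mult-core-top) top
    ... | tri> _ _ j<i        = subst (_≤ mult (suc i) xs) (sym (mult-core-> j<i)) z≤n

sum-replicate : ∀ a v → sum (replicate a v) ≡ a * v
sum-replicate zero    v = refl
sum-replicate (suc a) v = cong (_+_ v) (sum-replicate a v)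

2*sum-staircase : ∀ a j → 2 * sum (staircase a j) ≡ a * j * suc j
2*sum-staircase a zero    = sym (trans (*-identityʳ (a * 0)) (*-zeroʳ a))
2*sum-staircase a (suc j) = begin
  2 * sum (replicate a (suc j) ++ staircase a j)       ≡⟨ cong (2 *_) (sum-++ (replicate a (suc j)) _) ⟩
  2 * (sum (replicate a (suc j)) + sum (staircase a j)) ≡⟨ *-distribˡ-+ 2 (sum (replicate a (suc j))) _ ⟩
  2 * sum (replicate a (suc j)) + 2 * sum (staircase a j)
    ≡⟨ cong₂ (λ x y → 2 * x + y) (sum-replicate a (suc j)) (2*sum-staircase a j) ⟩
  2 * (a * suc j) + a * j * suc j                        ≡⟨ identity a j ⟩
  a * suc j * suc (suc j)                                ∎
  where
  open ≡-Reasoning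
  identity : ∀ a j → 2 * (a * suc j) + a * j * suc j ≡ a * suc j * suc (suc j)
  identity = ℕ.solve-∀

2*sum-core : ∀ r′ k → 2 * sum (core r′ k) + k ≡ suc r′ * k * k + r′ * k
2*sum-core r′ zero    = sym (cong₂ _+_ (*-zeroʳ (suc r′ * 0)) (*-zeroʳ r′))
2*sum-core r′ (suc j) = begin
  2 * sum (replicate r′ (suc j) ++ staircase (suc r′) j) + suc j
    ≡⟨ cong (λ s → 2 * s + suc j) (sum-++ (replicate r′ (suc j)) _) ⟩
  2 * (sum (replicate r′ (suc j)) + sum (staircase (suc r′) j)) + suc j
    ≡⟨ cong (_+ suc j) (*-distribˡ-+ 2 (sum (replicate r′ (suc j))) _) ⟩
  2 * sum (replicate r′ (suc j)) + 2 * sum (staircase (suc r′) j) + suc j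
    ≡⟨ cong₂ (λ x y → 2 * x + y + suc j) (sum-replicate r′ (suc j)) (2*sum-staircase (suc r′) j) ⟩
  2 * (r′ * suc j) + suc r′ * j * suc j + suc j
    ≡⟨ identity r′ j ⟩
  suc r′ * suc j * suc j + r′ * suc j
    ∎
  where
  open ≡-Reasoning
  identity : ∀ r′ j → 2 * (r′ * suc j) + suc r′ * j * suc j + suc j ≡ suc r′ * suc j * suc j + r′ * suc j
  identity = ℕ.solve-∀

P-core : ∀ r′ k → P (+ suc r′ ℤ.+ + 2) (ℤ.- + k) ≡ + sum (core r′ k)
P-core r′ k = begin
  numerator ℤ./ + 2          ≡⟨ cong (ℤ._/ + 2) numerator≡ ⟩
  + (2 * c) ℤ./ + 2          ≡⟨ div-pos-is-/ℕ (+ (2 * c)) 2 ⟩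
  + (2 * c Data.Nat./ 2)     ≡⟨ cong +_ (trans (cong (Data.Nat._/ 2) (*-comm 2 c)) (m*n/n≡m c 2)) ⟩
  + c                        ∎
  where
  open ≡-Reasoning
  c = sum (core r′ k)
  numerator = (ℤ.- + k) ℤ.* (ℤ.- + k) ℤ.* ((+ suc r′ ℤ.+ + 2) ℤ.- + 2)
              ℤ.- (ℤ.- + k) ℤ.* ((+ suc r′ ℤ.+ + 2) ℤ.- + 4)
  expand : ∀ R K → (ℤ.- K) ℤ.* (ℤ.- K) ℤ.* ((+ 1 ℤ.+ R ℤ.+ + 2) ℤ.- + 2)
                   ℤ.- (ℤ.- K) ℤ.* ((+ 1 ℤ.+ R ℤ.+ + 2) ℤ.- + 4)
                 ≡ ((+ 1 ℤ.+ R) ℤ.* K ℤ.* K ℤ.+ R ℤ.* K) ℤ.- K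
  expand = ℤ.solve-∀
  cancel : ∀ X K → (X ℤ.+ K) ℤ.- K ≡ X
  cancel = ℤ.solve-∀
  cast : + (suc r′ * k * k + r′ * k) ≡ + suc r′ ℤ.* + k ℤ.* + k ℤ.+ + r′ ℤ.* + k
  cast = trans (ℤ.pos-+ (suc r′ * k * k) (r′ * k)) (cong₂ ℤ._+_
    (trans (ℤ.pos-* (suc r′ * k) k) (cong (ℤ._* + k) (ℤ.pos-* (suc r′) k))) (ℤ.pos-* r′ k))
  numerator≡ : numerator ≡ + (2 * c)
  numerator≡ = begin
    numerator                                             ≡⟨ expand (+ r′) (+ k) ⟩
    (+ suc r′ ℤ.* + k ℤ.* + k ℤ.+ + r′ ℤ.* + k) ℤ.- + k ≡⟨ cong (ℤ._- + k) cast ⟨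
    + (suc r′ * k * k + r′ * k) ℤ.- + k                   ≡⟨ cong (λ m → + m ℤ.- + k) (2*sum-core r′ k) ⟨
    + (2 * c + k) ℤ.- + k                                 ≡⟨ cong (ℤ._- + k) (ℤ.pos-+ (2 * c) k) ⟩
    + (2 * c) ℤ.+ + k ℤ.- + k                             ≡⟨ cancel (+ (2 * c)) (+ k) ⟩
    + (2 * c)                                             ∎

staircase-positive : ∀ a j → All (1 ≤_) (staircase a j)
staircase-positive a zero    = []
staircase-positive a (suc j) = All.++⁺ (All.replicate⁺ a (s≤s z≤n)) (staircase-positive a j)

core-positive : ∀ r′ k → All (1 ≤_) (core r′ k)
core-positive r′ zero    = []
core-positive r′ (suc j) = All.++⁺ (All.replicate⁺ r′ (s≤s z≤n)) (staircase-positive (suc r′) j)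

-- The search for g_r

module _ (r : ℕ) (xs : List ℕ) where

  gSearch-≥ : ∀ f j → j ≤ gSearch f r j xs
  gSearch-≥ zero    j = ≤-refl
  gSearch-≥ (suc f) j with mult j xs <ᵇ r
  ... | true  = ≤-refl
  ... | false = ≤-trans (n≤1+n j) (gSearch-≥ f (suc j))

  gSearch-≤ : ∀ f j → gSearch f r j xs ≤ j + f
  gSearch-≤ zero    j = m≤m+n j 0
  gSearch-≤ (suc f) j with mult j xs <ᵇ r
  ... | true  = m≤m+n j (suc f)
  ... | false = subst (gSearch f r (suc j) xs ≤_) (sym (+-suc j f)) (gSearch-≤ f (suc j))

  gSearch-below : ∀ f j {i} → j ≤ i → i < gSearch f r j xs → r ≤ mult i xs
  gSearch-below zero    j j≤i i<j = ⊥-elim (<⇒≱ i<j j≤i)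
  gSearch-below (suc f) j {i} j≤i i< with mult j xs <ᵇ r | <ᵇ-reflects-< (mult j xs) r
  ... | true  | _         = ⊥-elim (<⇒≱ i< j≤i)
  ... | false | ofⁿ mult≮r with i ≟ j
  ...   | yes refl = ≮⇒≥ mult≮r
  ...   | no i≢j   = gSearch-below f (suc j) (≤∧≢⇒< j≤i (i≢j ∘ sym)) i<

  gSearch-found : ∀ f j → mult (gSearch f r j xs) xs < r ⊎ gSearch f r j xs ≡ j + f
  gSearch-found zero    j = inj₂ (sym (+-identityʳ j))
  gSearch-found (suc f) j with mult j xs <ᵇ r | <ᵇ-reflects-< (mult j xs) r
  ... | true  | ofʸ mult<r = inj₁ mult<r
  ... | false | _ with gSearch-found f (suc j)
  ...   | inj₁ found = inj₁ found
  ...   | inj₂ end   = inj₂ (trans end (sym (+-suc j f)))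

  1≤g : 1 ≤ g r xs
  1≤g = gSearch-≥ (length xs) 1

  g≤1+length : g r xs ≤ suc (length xs)
  g≤1+length = gSearch-≤ (length xs) 1

  mult<g : ∀ {i} → 1 ≤ i → i < g r xs → r ≤ mult i xs
  mult<g = gSearch-below (length xs) 1

-- If the search ran out of fuel, xs would contain 1, 2, …, |xs| + 1, which has more parts than xs.
mult-g<r : ∀ r xs → 1 ≤ r → mult (g r xs) xs < r
mult-g<r r xs 1≤r with gSearch-found r xs (length xs) 1
... | inj₁ found = found
... | inj₂ g≡1+len with mult (g r xs) xs <? r
...   | yes found    = found
...   | no not-found = ⊥-elim (1+n≰n (begin
  suc (length xs)                         ≡⟨ *-identityʳ (suc (length xs)) ⟨
  suc (length xs) * 1                     ≡⟨ length-staircase 1 (suc (length xs)) ⟨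
  length (staircase 1 (suc (length xs)))  ≤⟨ contains⇒length≤ (staircase 1 _) xs (contains-staircase 1 _ xs occupied) ⟩
  length xs                               ∎))
  where
  open ≤-Reasoning
  occupied : ∀ {i} → 1 ≤ i → i ≤ suc (length xs) → 1 ≤ mult i xs
  occupied {i} 1≤i i≤1+len with m≤n⇒m<n∨m≡n (subst (i ≤_) (sym g≡1+len) i≤1+len)
  ... | inj₁ i<g  = ≤-trans 1≤r (mult<g r xs 1≤i i<g)
  ... | inj₂ refl = ≤-trans 1≤r (≮⇒≥ not-found)

g-suc<g⇔ : ∀ r xs → 1 ≤ r → g (suc r) xs < g r xs ⇔ r ≤ mult (g (suc r) xs) xs
g-suc<g⇔ r xs 1≤r = mk⇔ (mult<g r xs (1≤g (suc r) xs)) from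
  where
  from : r ≤ mult (g (suc r) xs) xs → g (suc r) xs < g r xs
  from r≤mult with <-cmp (g (suc r) xs) (g r xs)
  ... | tri< g′<g _ _ = g′<g
  ... | tri≈ _ g′≡g _ = ⊥-elim (<⇒≱ (mult-g<r r xs 1≤r) (subst (λ i → r ≤ mult i xs) g′≡g r≤mult))
  ... | tri> _ _ g<g′ =
    ⊥-elim (<⇒≱ (mult-g<r r xs 1≤r) (≤-trans (n≤1+n r) (mult<g (suc r) xs (1≤g r xs) g<g′)))

g∞<g∞-pred⇔ : ∀ r′ xs → T (g∞ (suc r′) xs <∞ᵇ g∞ r′ xs) ⇔ r′ ≤ mult (g (suc r′) xs) xs
g∞<g∞-pred⇔ zero     xs = mk⇔ (λ _ → z≤n) (λ _ → _)
g∞<g∞-pred⇔ (suc r″) xs = mk⇔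
  (Equivalence.to (g-suc<g⇔ (suc r″) xs (s≤s z≤n)) ∘ <ᵇ⇒< _ _)
  (<⇒<ᵇ ∘ Equivalence.from (g-suc<g⇔ (suc r″) xs (s≤s z≤n)))

indicator : Bool → ℕ
indicator b = if b then 1 else 0

indicator-true : ∀ {b} → T b → indicator b ≡ 1
indicator-true {true} _ = refl

indicator-false : ∀ {b} → ¬ T b → indicator b ≡ 0
indicator-false {false} _  = refl
indicator-false {true}  ¬b = ⊥-elim (¬b _)

T-⇔⇒≡ : ∀ {a b} → T a ⇔ T b → a ≡ b
T-⇔⇒≡ {true}  {true}  _   = refl
T-⇔⇒≡ {true}  {false} a⇔b = ⊥-elim (Equivalence.to a⇔b _)
T-⇔⇒≡ {false} {true}  a⇔b = ⊥-elim (Equivalence.from a⇔b _)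
T-⇔⇒≡ {false} {false} _   = refl

sumTo-cong : ∀ K {f h : ℕ → ℕ} → (∀ k → f k ≡ h k) → sumTo K f ≡ sumTo K h
sumTo-cong zero    f≗h = refl
sumTo-cong (suc K) f≗h = cong₂ _+_ (sumTo-cong K f≗h) (f≗h K)

sumTo-ones : ∀ {γ} (h : ℕ → ℕ) → (∀ {k} → k < γ → h k ≡ 1) → sumTo γ h ≡ γ
sumTo-ones {zero}  h ones = refl
sumTo-ones {suc γ} h ones =
  trans (cong₂ _+_ (sumTo-ones h (ones ∘ m<n⇒m<1+n)) (ones (n<1+n γ))) (+-comm γ 1)

sumTo-step : ∀ {γ} K (h : ℕ → ℕ) → (∀ {k} → k < γ → h k ≡ 1) → (∀ {k} → γ < k → h k ≡ 0) →
             γ < K → sumTo K h ≡ γ + h γ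
sumTo-step {γ} (suc K) h ones zeros (s≤s γ≤K) with m≤n⇒m<n∨m≡n γ≤K
... | inj₂ refl = cong (_+ h γ) (sumTo-ones h ones)
... | inj₁ γ<K  = trans (cong₂ _+_ (sumTo-step K h ones zeros γ<K) (zeros γ<K)) (+-identityʳ _)

length-filterᵇ : ∀ {A : Set} (q : A → Bool) xs → length (filterᵇ q xs) ≡ sum (map (indicator ∘ q) xs)
length-filterᵇ q []       = refl
length-filterᵇ q (x ∷ xs) with q x
... | true  = cong suc (length-filterᵇ q xs)
... | false = length-filterᵇ q xs

sum-map-+ : ∀ {A : Set} (f h : A → ℕ) xs → sum (map (λ x → f x + h x) xs) ≡ sum (map f xs) + sum (map h xs)
sum-map-+ f h []       = refl
sum-map-+ f h (x ∷ xs) = trans (cong (_+_ (f x + h x)) (sum-map-+ f h xs)) (interchange (f x) (h x) _ _)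

sum-map-sumTo : ∀ {A : Set} K (H : ℕ → A → ℕ) xs →
  sum (map (λ x → sumTo K (λ k → H k x)) xs) ≡ sumTo K (λ k → sum (map (H k) xs))
sum-map-sumTo zero    H []       = refl
sum-map-sumTo zero    H (x ∷ xs) = sum-map-sumTo zero H xs
sum-map-sumTo (suc K) H xs = trans (sum-map-+ (λ x → sumTo K (λ k → H k x)) (H K) xs)
                                   (cong (_+ sum (map (H K) xs)) (sum-map-sumTo K H xs))

pℤ-core : ∀ n r′ k → pℤ (+ n ℤ.- P (+ suc r′ ℤ.+ + 2) (ℤ.- + k)) ≡ count (contains (core r′ k)) n
pℤ-core n r′ k = begin
  pℤ (+ n ℤ.- P (+ suc r′ ℤ.+ + 2) (ℤ.- + k))  ≡⟨ cong (λ c → pℤ (+ n ℤ.- c)) (P-core r′ k) ⟩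
  pℤ (+ n ℤ.- + sum (core r′ k))              ≡⟨ cong pℤ (ℤ.m-n≡m⊖n n (sum (core r′ k))) ⟩
  pℤ (n ⊖ sum (core r′ k))                    ≡⟨ count-contains (core r′ k) n (core-positive r′ k) ⟨
  count (contains (core r′ k)) n              ∎
  where open ≡-Reasoning

sumTo-contains-core : ∀ r′ xs K → suc (length xs) < K →
  sumTo K (λ k → indicator (contains (core r′ k) xs))
    ≡ g (suc r′) xs + indicator (g∞ (suc r′) xs <∞ᵇ g∞ r′ xs)
sumTo-contains-core r′ xs K 1+len<K =
  trans (sumTo-step K h ones zeros (≤-<-trans (g≤1+length (suc r′) xs) 1+len<K)) (cong (_+_ γ) at-γ)
  where
  γ = g (suc r′) xs
  h = λ k → indicator (contains (core r′ k) xs)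
  module Core j = Equivalence (contains-core⇔ r′ j xs)
  below : ∀ {j} → suc j ≤ γ → ∀ i → 1 ≤ i → i ≤ j → suc r′ ≤ mult i xs
  below 1+j≤γ i 1≤i i≤j = mult<g (suc r′) xs 1≤i (<-≤-trans (s≤s i≤j) 1+j≤γ)
  ones : ∀ {k} → k < γ → h k ≡ 1
  ones {zero}  _     = refl
  ones {suc j} 1+j<γ = indicator-true (Core.from j
    (below (<⇒≤ 1+j<γ) , ≤-trans (n≤1+n r′) (mult<g (suc r′) xs (s≤s z≤n) 1+j<γ)))
  zeros : ∀ {k} → γ < k → h k ≡ 0
  zeros {suc j} (s≤s γ≤j) = indicator-false λ core⊑xs →
    <⇒≱ (mult-g<r (suc r′) xs (s≤s z≤n)) (proj₁ (Core.to j core⊑xs) γ (1≤g (suc r′) xs) γ≤j)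
  j = pred γ
  1+j≡γ : suc j ≡ γ
  1+j≡γ = suc-pred γ {{>-nonZero (1≤g (suc r′) xs)}}
  top⇔test : r′ ≤ mult (suc j) xs ⇔ T (g∞ (suc r′) xs <∞ᵇ g∞ r′ xs)
  top⇔test = mk⇔
    (Equivalence.from (g∞<g∞-pred⇔ r′ xs) ∘ subst (λ i → r′ ≤ mult i xs) 1+j≡γ)
    (subst (λ i → r′ ≤ mult i xs) (sym 1+j≡γ) ∘ Equivalence.to (g∞<g∞-pred⇔ r′ xs))
  at-γ : h γ ≡ indicator (g∞ (suc r′) xs <∞ᵇ g∞ r′ xs)
  at-γ = trans (cong h (sym 1+j≡γ)) (cong indicator (T-⇔⇒≡ (mk⇔
    (Equivalence.to top⇔test ∘ proj₂ ∘ Core.to j)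
    (λ test → Core.from j (below (≤-reflexive 1+j≡γ) , Equivalence.from top⇔test test)))))

theorem3 : (n r : ℕ) → 1 ≤ r → (K : ℕ) → n + 2 ≤ K →
    sumTo K (λ k → pℤ (+ n ℤ.- P (+ r ℤ.+ + 2) (ℤ.- + k))) ≡ S r n + G r n
theorem3 n zero    () K n+2≤K
theorem3 n (suc r′) _ K n+2≤K = begin
  sumTo K (λ k → pℤ (+ n ℤ.- P (+ suc r′ ℤ.+ + 2) (ℤ.- + k)))
    ≡⟨ sumTo-cong K (λ k → trans (pℤ-core n r′ k) (length-filterᵇ (contains (core r′ k)) (partitions n))) ⟩
  sumTo K (λ k → sum (map (indicator ∘ contains (core r′ k)) (partitions n)))
    ≡⟨ sum-map-sumTo K (λ k → indicator ∘ contains (core r′ k)) (partitions n) ⟨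
  sum (map (λ xs → sumTo K (λ k → indicator (contains (core r′ k) xs))) (partitions n))
    ≡⟨ cong sum (map-cong-local (All.tabulate (λ xs∈ → sumTo-contains-core r′ _ K (bound xs∈)))) ⟩
  sum (map (λ xs → g (suc r′) xs + indicator (test xs)) (partitions n))
    ≡⟨ sum-map-+ (g (suc r′)) (indicator ∘ test) (partitions n) ⟩
  S (suc r′) n + sum (map (indicator ∘ test) (partitions n))
    ≡⟨ cong (_+_ (S (suc r′) n)) (length-filterᵇ test (partitions n)) ⟨
  S (suc r′) n + G (suc r′) n
    ∎
  where
  open ≡-Reasoning
  test = λ xs → g∞ (suc r′) xs <∞ᵇ g∞ r′ xs
  bound : ∀ {xs} → xs ∈ partitions n → suc (length xs) < K
  bound xs∈ = ≤-trans (s≤s (s≤s (length≤n xs∈))) (subst (_≤ K) (+-comm n 2) n+2≤K)
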